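{- Let $m\geq 2$ and $n\geq 2$ be integers, let $G_m$ be a connected graph of order $m$ and let $H_n$ be a connected graph of order $n$. Then $rvc(G_m \diamond H_n) \geq rvc(G_m)$.
   Context: All graphs are finite, simple, connected and undirected. For a graph $G$ and $k\in\mathbb{N}$, a rainbow vertex $k$-coloring of $G$ is a function $c: V(G)\to\{1,\dots,k\}$ such that for every two vertices $u,v$ of $G$ there is a $u$–$v$ path whose internal vertices have pairwise distinct colors. The rainbow vertex connection number $rvc(G)$ is the smallest positive integer $k$ such that $G$ has a rainbow vertex $k$-coloring. The edge corona $G\diamond H$ of graphs $G$ and $H$ (on disjoint vertex sets) is obtained from one copy of $G$ and $|E(G)|$ copies of $H$, where, enumerating the edges of $G$ as $e_1,\dots,e_{|E(G)|}$, both end vertices of $e_j$ are joined by an edge to every vertex of the $j$-th copy of $H$. -}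

module Defs where

open import Data.Nat using (ℕ; zero; suc; _<_; _≤_; _≥_)
open import Data.Fin using (Fin; toℕ)
open import Data.Bool using (Bool; true; false; T)
open import Data.Product using (Σ; ∃; ∃-syntax; _×_; _,_)
open import Data.Sum using (_⊎_; inj₁; inj₂)
open import Data.List using (List; []; _∷_; map)
open import Data.List.Relation.Unary.AllPairs using (AllPairs)
open import Data.List.Relation.Unary.Unique.Propositional using (Unique)
open import Relation.Binary.PropositionalEquality using (_≡_; _≢_)
open import Relation.Nullary using (¬_)

record Graph (n : ℕ) : Set where
  field
    adj     : Fin n → Fin n → Bool
    symm    : ∀ u v → adj u v ≡ adj v u
    irrefl  : ∀ v → adj v v ≡ false
open Graph public

data Walk {V : Set} (_~_ : V → V → Set) : V → V → List V → Set where
  -- Walk _~_ u v is : a walk from u to v whose internal vertices are is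
  single : ∀ {u} → Walk _~_ u u []
  edge   : ∀ {u v} → u ~ v → Walk _~_ u v []
  step   : ∀ {u w v is} → u ~ w → Walk _~_ w v is → Walk _~_ u v (w ∷ is)

open import Data.List using (_++_; [_])

IsPath : {V : Set} → V → V → List V → Set
IsPath u v is = Unique (u ∷ is ++ [ v ]) ⊎ (u ≡ v × is ≡ [])

Connected : {V : Set} (_~_ : V → V → Set) → Set
Connected {V} _~_ = ∀ (u v : V) → ∃[ is ] Walk _~_ u v is

RainbowVertexColoring : {V : Set} (_~_ : V → V → Set) (k : ℕ) (c : V → Fin k) → Set
RainbowVertexColoring {V} _~_ k c =
  ∀ (u v : V) → ∃[ is ] (Walk _~_ u v is × IsPath u v is × Unique (map c is))

HasRVC : {V : Set} (_~_ : V → V → Set) (k : ℕ) → Set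
HasRVC {V} _~_ k = ∃[ c ] RainbowVertexColoring {V} _~_ k c

IsRVC : {V : Set} (_~_ : V → V → Set) (r : ℕ) → Set
IsRVC _~_ r = 1 ≤ r × HasRVC _~_ r × (∀ k → 1 ≤ k → k < r → ¬ HasRVC _~_ k)

Adj : ∀ {n} → Graph n → Fin n → Fin n → Set
Adj G u v = T (adj G u v)

ConnectedGraph : ∀ {n} → Graph n → Set
ConnectedGraph G = Connected (Adj G)

rvcIs : ∀ {n} → Graph n → ℕ → Set
rvcIs G r = IsRVC (Adj G) r

-- Edge corona G ◇ H.  The edges of G are indexed by pairs (u , v) with
-- toℕ u < toℕ v and u ~ v (each edge exactly once); copy j of H is
-- indexed by such an edge.

EdgeG : ∀ {m} → Graph m → Set
EdgeG {m} G = Σ (Fin m × Fin m) λ { (u , v) → toℕ u < toℕ v × Adj G u v }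

CoronaV : ∀ {m n} → Graph m → Graph n → Set
CoronaV {m} {n} G H = Fin m ⊎ (EdgeG G × Fin n)

data CoronaAdj {m n} (G : Graph m) (H : Graph n) : CoronaV G H → CoronaV G H → Set where
  base  : ∀ {u v} → Adj G u v → CoronaAdj G H (inj₁ u) (inj₁ v)
  copy  : ∀ {e x y} → Adj H x y → CoronaAdj G H (inj₂ (e , x)) (inj₂ (e , y))
  endL→ : ∀ {u v p x} → CoronaAdj G H (inj₁ u) (inj₂ (((u , v) , p) , x))
  endR→ : ∀ {u v p x} → CoronaAdj G H (inj₁ v) (inj₂ (((u , v) , p) , x))
  endL← : ∀ {u v p x} → CoronaAdj G H (inj₂ (((u , v) , p) , x)) (inj₁ u)
  endR← : ∀ {u v p x} → CoronaAdj G H (inj₂ (((u , v) , p) , x)) (inj₁ v)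

{-# OPTIONS --safe #-}
-- A walk in G ◇ H between two vertices of G projects to G: a detour into the
-- copy of H attached to an edge ab enters and leaves at a or b, which are equal
-- or adjacent, so deleting the copy vertices leaves a walk in G up to repeated
-- vertices.  Shortening that walk to a path only deletes internal vertices, so
-- the internal colours stay pairwise distinct.  Hence a rainbow vertex
-- k-colouring of G ◇ H restricts to one of G, and rvc(G) ≤ rvc(G ◇ H).
module Submission where

open import Defs
open import Data.Nat using (ℕ; _≤_)
open import Data.Nat.Properties using (≮⇒≥)
open import Data.Fin using (Fin)
open import Data.Fin.Properties renaming (_≟_ to _≟ᶠ_)
open import Data.Bool using (T)
open import Data.Product using (∃-syntax; _×_; _,_)
open import Data.Sum using (inj₁; inj₂)
open import Data.Empty using (⊥-elim)
open import Data.List using (List; []; _∷_; map; _++_; [_])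
open import Data.List.Properties using (map-∘)
open import Data.List.Relation.Unary.All using ([]; _∷_)
open import Data.List.Relation.Unary.All.Properties using (¬Any⇒All¬)
import Data.List.Relation.Unary.All.Properties as All
open import Data.List.Relation.Unary.AllPairs using (AllPairs; []; _∷_)
open import Data.List.Relation.Unary.Unique.Propositional using (Unique)
open import Data.List.Membership.Propositional using (_∈_)
import Data.List.Membership.DecPropositional as DecMembership
open import Data.List.Relation.Unary.Any using (here; there)
open import Data.List.Relation.Binary.Sublist.Propositional
  using (_⊆_; []; _∷_; _∷ʳ_; ⊆-refl; ⊆-trans; minimum)
open import Data.List.Relation.Binary.Sublist.Propositional.Properties
  using (All-resp-⊆; map⁺; ∷ˡ⁻)
import Data.List.Relation.Binary.Sublist.Propositional.Properties as Sublist
open import Function using (_∘_)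
open import Relation.Binary.Definitions using (DecidableEquality)
open import Relation.Binary.Construct.Closure.Reflexive using (ReflClosure)
import Relation.Binary.Construct.Closure.Reflexive as Refl
open import Relation.Binary.PropositionalEquality using (_≡_; _≢_; refl; sym; subst)
open import Relation.Nullary using (yes; no)

AllPairs-resp-⊆ : ∀ {A : Set} {R : A → A → Set} {xs ys : List A} →
  xs ⊆ ys → AllPairs R ys → AllPairs R xs
AllPairs-resp-⊆ []             []         = []
AllPairs-resp-⊆ (_ ∷ʳ xs⊆ys)   (_ ∷ pys)  = AllPairs-resp-⊆ xs⊆ys pys
AllPairs-resp-⊆ (refl ∷ xs⊆ys) (py ∷ pys) = All-resp-⊆ xs⊆ys py ∷ AllPairs-resp-⊆ xs⊆ys pys

IsPath⇒Unique-tail : ∀ {V : Set} {w v : V} {ks} → IsPath w v ks → Unique (ks ++ [ v ])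
IsPath⇒Unique-tail (inj₁ (_ ∷ unique)) = unique
IsPath⇒Unique-tail (inj₂ (_ , refl))   = [] ∷ []

module Shortcut {V : Set} (_≟_ : DecidableEquality V) {_~_ : V → V → Set} where

  open DecMembership _≟_ using (_∈?_)

  ShortPath : V → V → List V → Set
  ShortPath u v is = ∃[ ks ] Walk _~_ u v ks × IsPath u v ks × ks ⊆ is

  trivial-path : ∀ {u is} → ShortPath u u is
  trivial-path = [] , single , inj₂ (refl , refl) , minimum _

  edge-path : ∀ {u v is} → u ~ v → u ≢ v → ShortPath u v is
  edge-path u~v u≢v = [] , edge u~v , inj₁ ((u≢v ∷ []) ∷ [] ∷ []) , minimum _

  ShortPath-mono : ∀ {u v is js} → is ⊆ js → ShortPath u v is → ShortPath u v js
  ShortPath-mono is⊆js (ks , W , P , ks⊆is) = ks , W , P , ⊆-trans ks⊆is is⊆js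

  reflClosure-strict : ∀ {u v} → ReflClosure _~_ u v → u ≢ v → u ~ v
  reflClosure-strict Refl.refl    u≢v = ⊥-elim (u≢v refl)
  reflClosure-strict Refl.[ u~v ] _   = u~v

  suffix-from : ∀ {w v ks u} → Walk _~_ w v ks → u ∈ ks →
    ∃[ ks′ ] Walk _~_ u v ks′ × u ∷ ks′ ⊆ ks
  suffix-from (step _ W) (here refl) = _ , W , ⊆-refl
  suffix-from (step _ W) (there u∈ks) with suffix-from W u∈ks
  ... | ks′ , W′ , u∷ks′⊆ks = ks′ , W′ , _ ∷ʳ u∷ks′⊆ks

  -- If u already occurs on the path from w, that path is cut just after u.
  prepend : ∀ {u w v ks} → ReflClosure _~_ u w → Walk _~_ w v ks → IsPath w v ks →
    ShortPath u v (w ∷ ks)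
  prepend {u} {w} {v} {ks} u~w W P with u ≟ v | u ≟ w | u ∈? ks
  ... | yes refl | _        | _ = trivial-path
  ... | no u≢v  | yes refl | _ = ks , W , P , w ∷ʳ ⊆-refl
  ... | no u≢v  | no u≢w   | yes u∈ks with suffix-from W u∈ks
  ...   | ks′ , W′ , u∷ks′⊆ks =
    ks′ , W′ ,
    inj₁ (AllPairs-resp-⊆ (Sublist.++⁺ u∷ks′⊆ks ⊆-refl) (IsPath⇒Unique-tail P)) ,
    w ∷ʳ ∷ˡ⁻ u∷ks′⊆ks
  prepend u~w W (inj₂ (refl , refl)) | no u≢v | no u≢w | no _ =
    edge-path (reflClosure-strict u~w u≢w) u≢w
  prepend u~w W (inj₁ unique)        | no u≢v | no u≢w | no u∉ks =
    _ , step (reflClosure-strict u~w u≢w) W ,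
    inj₁ ((u≢w ∷ All.++⁺ (¬Any⇒All¬ _ u∉ks) (u≢v ∷ [])) ∷ unique) , ⊆-refl

  shortcut : ∀ {u v is} → Walk (ReflClosure _~_) u v is → ShortPath u v is
  shortcut single = trivial-path
  shortcut {u} {v} (edge u~v) with u ≟ v
  ... | yes refl = trivial-path
  ... | no u≢v   = edge-path (reflClosure-strict u~v u≢v) u≢v
  shortcut (step u~w W) with shortcut W
  ... | ks , W′ , P , ks⊆is = ShortPath-mono (refl ∷ ks⊆is) (prepend u~w W′ P)

module _ {m n : ℕ} (G : Graph m) (H : Graph n) where

  open Shortcut _≟ᶠ_ {Adj G}

  data End : EdgeG G → Fin m → Set where
    left  : ∀ {a b p} → End ((a , b) , p) a
    right : ∀ {a b p} → End ((a , b) , p) b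

  ends-adjacent : ∀ {e u w} → End e u → End e w → ReflClosure (Adj G) u w
  ends-adjacent left                          left  = Refl.refl
  ends-adjacent (left {p = _ , a~b})          right = Refl.[ a~b ]
  ends-adjacent (right {a} {b} {p = _ , a~b}) left  = Refl.[ subst T (symm G a b) a~b ]
  ends-adjacent right                         right = Refl.refl

  -- The vertices of G that a vertex of G ◇ H stands in for.
  Shadow : CoronaV G H → Fin m → Set
  Shadow (inj₁ w)       u = u ≡ w
  Shadow (inj₂ (e , _)) u = End e u

  shadow-step-base : ∀ {p w u} → CoronaAdj G H p (inj₁ w) → Shadow p u →
    ReflClosure (Adj G) u w
  shadow-step-base (base u~w) refl = Refl.[ u~w ]
  shadow-step-base endL←      s    = ends-adjacent s left
  shadow-step-base endR←      s    = ends-adjacent s right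

  shadow-step-copy : ∀ {p q u} → CoronaAdj G H p (inj₂ q) → Shadow p u → Shadow (inj₂ q) u
  shadow-step-copy (copy _) s    = s
  shadow-step-copy endL→    refl = left
  shadow-step-copy endR→    refl = right

  project : ∀ {p v is u} → Walk (CoronaAdj G H) p (inj₁ v) is → Shadow p u →
    ∃[ js ] Walk (ReflClosure (Adj G)) u v js × map inj₁ js ⊆ is
  project single refl = [] , single , []
  project (edge p~v) s = [] , edge (shadow-step-base p~v s) , []
  project (step {w = inj₁ w} p~w W) s with project W refl
  ... | js , W′ , js⊆is = w ∷ js , step (shadow-step-base p~w s) W′ , refl ∷ js⊆is
  project (step {w = inj₂ q} p~q W) s with project W (shadow-step-copy p~q s)
  ... | js , W′ , js⊆is = js , W′ , _ ∷ʳ js⊆is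

  restrict-rainbow : ∀ k (c : CoronaV G H → Fin k) →
    RainbowVertexColoring (CoronaAdj G H) k c → RainbowVertexColoring (Adj G) k (c ∘ inj₁)
  restrict-rainbow k c rainbow u v =
    let is , W , _ , distinct      = rainbow (inj₁ u) (inj₁ v)
        js , W′ , js⊆is            = project W refl
        ks , P , isPath , ks⊆js    = shortcut W′
        colours⊆ : map (c ∘ inj₁) ks ⊆ map c is
        colours⊆ = subst (_⊆ map c is) (sym (map-∘ {g = c} {f = inj₁} ks))
                     (map⁺ c (⊆-trans (map⁺ inj₁ ks⊆js) js⊆is))
    in ks , P , isPath , AllPairs-resp-⊆ colours⊆ distinct

mainTheorem1 : (m n : ℕ) → 2 ≤ m → 2 ≤ n →
    (G : Graph m) (H : Graph n) → ConnectedGraph G → ConnectedGraph H →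
    (a b : ℕ) → IsRVC (CoronaAdj G H) a → rvcIs G b → b ≤ a
mainTheorem1 _ _ _ _ G H _ _ a b (1≤a , (c , rainbow) , _) (_ , _ , b-least) =
  ≮⇒≥ λ a<b → b-least a 1≤a a<b (c ∘ inj₁ , restrict-rainbow G H a c rainbow)
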